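{- Let $n$ and $k$ be integers with $4\leq k\leq n$ and $k$ even, and let $M\subseteq E(K_n)$ be an edge set such that $|M|\geq k$ and $\Delta(K_n[M])\geq 2$. Then $\lambda_k(K_n\setminus M)< n-\frac{k}{2}-1$.
   Context: For a graph $G$ and $S\subseteq V(G)$ with $|S|\geq 2$, an $S$-tree is a subgraph of $G$ that is a tree containing all vertices of $S$; $\lambda(S)$ is the maximum number of pairwise edge-disjoint $S$-trees in $G$, and $\lambda_k(G)=\min\{\lambda(S): S\subseteq V(G),\ |S|=k\}$ (with $\lambda_k(G)=0$ if $G$ is disconnected). $K_n\setminus M$ is $K_n$ with the edges of $M$ deleted, $K_n[M]$ is the subgraph of $K_n$ induced by the edge set $M$, and $\Delta$ denotes maximum degree. -}

module Defs where

open import Data.Nat using (ℕ; zero; suc; _≤_)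
open import Data.Fin using (Fin; _≟_) renaming (_<_ to _<ᶠ_)
open import Data.Fin.Subset using (Subset; ∣_∣) renaming (_∈_ to _∈ˢ_)
open import Data.Product using (Σ; ∃; _×_; _,_; proj₁; proj₂)
open import Data.Sum using (_⊎_)
open import Data.List using (List; []; _∷_; _++_; [_]; length)
open import Data.List.Membership.Propositional using (_∈_)
open import Data.List.Relation.Unary.All using (All)
open import Data.List.Relation.Unary.Linked using (Linked)
open import Data.List.Relation.Unary.Unique.Propositional using (Unique)
open import Relation.Binary.PropositionalEquality using (_≡_; _≢_)
open import Relation.Nullary using (¬_; yes; no)

Edge : ℕ → Set
Edge n = Fin n × Fin n

-- An edge set M ⊆ E(K_n): a duplicate-free list of pairs (u , v) with u < v,
-- so each unordered edge of K_n is represented exactly once.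
IsEdgeSetOfKn : ∀ {n} → List (Edge n) → Set
IsEdgeSetOfKn M = All (λ e → proj₁ e <ᶠ proj₂ e) M × Unique M

EdgeIn : ∀ {n} → List (Edge n) → Fin n → Fin n → Set
EdgeIn E u v = ((u , v) ∈ E) ⊎ ((v , u) ∈ E)

deg : ∀ {n} → List (Edge n) → Fin n → ℕ
deg [] v = zero
deg ((a , b) ∷ M) v with a ≟ v | b ≟ v
... | no _ | no _ = deg M v
... | _    | _    = suc (deg M v)

MaxDeg≥ : ∀ {n} → List (Edge n) → ℕ → Set
MaxDeg≥ {n} M d = Σ (Fin n) λ v → d ≤ deg M v

Graph : ℕ → Set₁
Graph n = Fin n → Fin n → Set

Kn∖ : ∀ {n} → List (Edge n) → Graph n
Kn∖ M u v = (u ≢ v) × ¬ EdgeIn M u v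

VertexOf : ∀ {n} → List (Edge n) → Fin n → Set
VertexOf T v = Σ (Fin _) λ w → EdgeIn T v w

data Walk {n} (T : List (Edge n)) : Fin n → Fin n → Set where
  here : ∀ {u} → Walk T u u
  step : ∀ {u v w} → EdgeIn T u v → Walk T v w → Walk T u w

Connected : ∀ {n} → List (Edge n) → Set
Connected T = ∀ u v → VertexOf T u → VertexOf T v → Walk T u v

Cycle : ∀ {n} → List (Edge n) → Set
Cycle {n} T = Σ (Fin n) λ v₀ → Σ (List (Fin n)) λ rest →
  (3 ≤ length (v₀ ∷ rest)) × Unique (v₀ ∷ rest) ×
  Linked (EdgeIn T) (v₀ ∷ rest ++ [ v₀ ])

Acyclic : ∀ {n} → List (Edge n) → Set
Acyclic T = ¬ Cycle T

IsTree : ∀ {n} → List (Edge n) → Set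
IsTree T = Connected T × Acyclic T

SubgraphOf : ∀ {n} → Graph n → List (Edge n) → Set
SubgraphOf G T = All (λ e → G (proj₁ e) (proj₂ e)) T

IsSTree : ∀ {n} → Graph n → Subset n → List (Edge n) → Set
IsSTree G S T = SubgraphOf G T × IsTree T × (∀ s → s ∈ˢ S → VertexOf T s)

EdgeDisjoint : ∀ {n} → List (Edge n) → List (Edge n) → Set
EdgeDisjoint T₁ T₂ = ∀ u v → EdgeIn T₁ u v → ¬ EdgeIn T₂ u v

HasDisjointSTrees : ∀ {n} → Graph n → Subset n → ℕ → Set
HasDisjointSTrees {n} G S m = Σ (Fin m → List (Edge n)) λ T →
  (∀ i → IsSTree G S (T i)) × (∀ i j → i ≢ j → EdgeDisjoint (T i) (T j))

-- λ_k(G) < m : some k-subset S has λ(S) < m, i.e. G has no m pairwise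
-- edge-disjoint S-trees.
LambdaK< : ∀ {n} → Graph n → ℕ → ℕ → Set
LambdaK< {n} G k m = Σ (Subset n) λ S → (∣ S ∣ ≡ k) × ¬ HasDisjointSTrees G S m

-- Choose S to contain both ends of an edge of M and further vertices so that k edges of M meet S; a
-- vertex of degree at least 2 in M lets one vertex of S serve two of these edges. An S-tree with a
-- vertex outside S uses at least k edges meeting S; an S-tree inside S uses at least k − 1 edges, all
-- inside S. In K_n there are k(n − k) + k(k − 1)/2 edges meeting S, k(k − 1)/2 of them inside S, and
-- M removes k of the former, one of them inside S. These counts leave room for fewer than
-- n − k/2 − 1 edge-disjoint S-trees.
module Submission where

open import Defs
open import Data.Nat using (ℕ; zero; suc; _+_; _*_; _∸_; _≤_; _<_; _/_; z≤n; s≤s; z<s)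
open import Data.Nat.Properties hiding (_≟_)
open import Data.Nat.Divisibility using (_∣_; divides)
open import Data.Nat.DivMod using (m*n/n≡m)
open import Data.Nat.Tactic.RingSolver using (solve-∀)
open import Data.Fin using (Fin; zero; suc; _≟_) renaming (_<_ to _<ᶠ_)
import Data.Fin.Properties as Fin
import Data.Vec as Vec
open import Data.Vec using (_∷_)
open import Data.Fin.Subset using (Subset; inside; outside; ⁅_⁆; _∪_; ∣_∣) renaming (_∈_ to _∈ˢ_; _∉_ to _∉ˢ_; ⊥ to ∅)
open import Data.Fin.Subset.Properties using (∉⊥; x∈⁅x⁆; x∈⁅y⁆⇒x≡y; x∈p∪q⁺; x∈p∪q⁻; ∪-identityˡ; ∣⊥∣≡0)
open import Data.List using (List; []; _∷_; _++_; [_]; length; map; filter; concat; tabulate; take; allFin; deduplicate)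
open import Data.List.Properties using (length-++; length-map; length-tabulate; length-take; filter-++; filter-all; filter-notAll; length-deduplicate)
open import Data.List.Membership.Propositional using (_∈_; _∉_; find)
open import Data.List.Membership.Propositional.Properties using (∈-map⁺; ∈-filter⁺; ∈-filter⁻; ∈-allFin; ∈-++⁺ˡ; ∈-++⁺ʳ; ∈-concat⁻′; ∈-tabulate⁻; ∈-deduplicate⁺)
import Data.List.Membership.DecPropositional as DecMembership
open import Data.List.Relation.Binary.Subset.Propositional using (_⊆_)
import Data.List.Relation.Binary.Sublist.Propositional as Sublist
import Data.List.Relation.Binary.Sublist.Setoid.Properties as SublistProperties
open import Data.List.Relation.Binary.Disjoint.Propositional using (Disjoint)
open import Data.List.Relation.Unary.Any as Any using (here; there)
open import Data.List.Relation.Unary.All as All using (All; []; _∷_; all?)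
open import Data.List.Relation.Unary.All.Properties using (¬Any⇒All¬; ¬All⇒Any¬; tabulate⁺) renaming (++⁺ to All-++⁺)
open import Data.List.Relation.Unary.AllPairs using ([]; _∷_)
import Data.List.Relation.Unary.AllPairs.Properties as AllPairs
open import Data.List.Relation.Unary.Unique.Propositional using (Unique)
open import Data.List.Relation.Unary.Unique.Propositional.Properties using (++⁺; concat⁺; filter⁺; take⁺; allFin⁺)
open import Data.List.Relation.Unary.Unique.DecPropositional.Properties using (deduplicate-!)
open import Data.Product as Product using (Σ; ∃; ∃₂; _×_; _,_; proj₁; proj₂)
open import Data.Product.Properties using (≡-dec)
open import Data.Sum as Sum using (_⊎_; inj₁; inj₂; [_,_]′)
open import Data.Empty using (⊥; ⊥-elim)
open import Function using (_∘_; id)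
open import Relation.Binary using (Symmetric; DecidableEquality; tri<; tri≈; tri>)
open import Relation.Binary.PropositionalEquality using (_≡_; _≢_; refl; sym; trans; cong; cong₂; subst; subst₂; setoid; module ≡-Reasoning)
open import Relation.Nullary using (¬_; yes; no; ¬?; _×-dec_; contradiction)
open import Relation.Unary using (Decidable)

module _ {A : Set} (_≟ₐ_ : DecidableEquality A) where

  Unique-⊆⇒length≤ : {xs ys : List A} → Unique xs → xs ⊆ ys → length xs ≤ length ys
  Unique-⊆⇒length≤ [] _ = z≤n
  Unique-⊆⇒length≤ {x ∷ xs} {ys} (x∉xs ∷ xs!) xs⊆ys = begin-strict
    length xs                         ≤⟨ Unique-⊆⇒length≤ xs! xs⊆ys-x ⟩
    length (filter (¬? ∘ (_≟ₐ x)) ys) <⟨ filter-notAll (¬? ∘ (_≟ₐ x)) ys x∈ys ⟩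
    length ys                         ∎
    where
      open ≤-Reasoning
      x∈ys = Any.map (λ x≡y y≢x → y≢x (sym x≡y)) (xs⊆ys (here refl))
      xs⊆ys-x : xs ⊆ filter (¬? ∘ (_≟ₐ x)) ys
      xs⊆ys-x y∈xs = ∈-filter⁺ (¬? ∘ (_≟ₐ x)) (xs⊆ys (there y∈xs)) (All.lookup x∉xs y∈xs ∘ sym)

module _ {A : Set} (w : List A → ℕ) (w-++ : ∀ xs ys → w (xs ++ ys) ≡ w xs + w ys) where

  additive-concat-lower-bound : ∀ {c} {xss : List (List A)} → All (λ xs → c ≤ w xs) xss →
                                length xss * c ≤ w (concat xss)
  additive-concat-lower-bound [] = z≤n
  additive-concat-lower-bound {xss = xs ∷ xss} (c≤w ∷ c≤ws) =
    subst (_ ≤_) (sym (w-++ xs (concat xss))) (+-mono-≤ c≤w (additive-concat-lower-bound c≤ws))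

module _ {n : ℕ} where
  open DecMembership (_≟_ {n}) using (_∈?_; _∉?_)

  length-allFin : length (allFin n) ≡ n
  length-allFin = length-tabulate id

  complementOf : List (Fin n) → List (Fin n)
  complementOf L = filter (_∉? L) (allFin n)

  length-complementOf+length≤ : (L : List (Fin n)) → Unique L → length (complementOf L) + length L ≤ n
  length-complementOf+length≤ L L! = subst₂ _≤_ (length-++ (complementOf L)) length-allFin
    (Unique-⊆⇒length≤ _≟_ (++⁺ (filter⁺ (_∉? L) (allFin⁺ n)) L! disjoint) (λ _ → ∈-allFin _))
    where
      disjoint : Disjoint (complementOf L) L
      disjoint (v∈C , v∈L) = proj₂ (∈-filter⁻ (_∉? L) {xs = allFin n} v∈C) v∈L

  ∃∉ : (L : List (Fin n)) → length L < n → ∃ λ w → w ∉ L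
  ∃∉ L L<n with all? (_∈? L) (allFin n)
  ... | yes allFin⊆L = contradiction
        (subst (_≤ length L) length-allFin (Unique-⊆⇒length≤ _≟_ (allFin⁺ n) (All.lookup allFin⊆L)))
        (<⇒≱ L<n)
  ... | no ¬allFin⊆L = let w , _ , w∉L = find (¬All⇒Any¬ (_∈? L) (allFin n) ¬allFin⊆L) in w , w∉L

  extend : ∀ j (L : List (Fin n)) → Unique L → length L + j ≤ n →
           ∃ λ L′ → Unique L′ × length L′ ≡ length L + j × L ⊆ L′
  extend zero L L! _ = L , L! , sym (+-identityʳ _) , id
  extend (suc j) L L! L+j≤n with ∃∉ L (≤-trans (s≤s (m≤m+n _ j)) (subst (_≤ n) (+-suc _ j) L+j≤n))
  ... | w , w∉L with extend j (w ∷ L) (¬Any⇒All¬ L w∉L ∷ L!) (subst (_≤ n) (+-suc _ j) L+j≤n)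
  ... | L′ , L′! , |L′| , w∷L⊆L′ = L′ , L′! , trans |L′| (sym (+-suc _ j)) , w∷L⊆L′ ∘ there

  Unique-superset-of-length : ∀ {k} (xs : List (Fin n)) → length xs ≤ k → k ≤ n →
                              ∃ λ L → Unique L × length L ≡ k × xs ⊆ L
  Unique-superset-of-length {k} xs xs≤k k≤n =
    let L , L! , |L| , ds⊆L = extend (k ∸ length ds) ds (deduplicate-! _≟_ xs)
                                (subst (_≤ n) (sym (m+[n∸m]≡n ds≤k)) k≤n)
    in L , L! , trans |L| (m+[n∸m]≡n ds≤k) , ds⊆L ∘ ∈-deduplicate⁺ _≟_
    where
      ds = deduplicate _≟_ xs
      ds≤k = ≤-trans (length-deduplicate _≟_ xs) xs≤k

fromList : ∀ {n} → List (Fin n) → Subset n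
fromList [] = ∅
fromList (x ∷ xs) = ⁅ x ⁆ ∪ fromList xs

∈-fromList⁺ : ∀ {n} {x : Fin n} {xs} → x ∈ xs → x ∈ˢ fromList xs
∈-fromList⁺ {x = x} (here refl) = x∈p∪q⁺ (inj₁ (x∈⁅x⁆ x))
∈-fromList⁺ (there x∈xs) = x∈p∪q⁺ (inj₂ (∈-fromList⁺ x∈xs))

∈-fromList⁻ : ∀ {n} {x : Fin n} xs → x ∈ˢ fromList xs → x ∈ xs
∈-fromList⁻ [] x∈∅ = contradiction x∈∅ ∉⊥
∈-fromList⁻ (y ∷ xs) x∈ with x∈p∪q⁻ ⁅ y ⁆ (fromList xs) x∈
... | inj₁ x∈⁅y⁆ = here (x∈⁅y⁆⇒x≡y y x∈⁅y⁆)
... | inj₂ x∈xs = there (∈-fromList⁻ xs x∈xs)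

∣⁅x⁆∪p∣≡1+∣p∣ : ∀ {n} (x : Fin n) (p : Subset n) → x ∉ˢ p → ∣ ⁅ x ⁆ ∪ p ∣ ≡ suc ∣ p ∣
∣⁅x⁆∪p∣≡1+∣p∣ zero (inside ∷ p) x∉p = contradiction Vec.here x∉p
∣⁅x⁆∪p∣≡1+∣p∣ zero (outside ∷ p) _ = cong (suc ∘ ∣_∣) (∪-identityˡ p)
∣⁅x⁆∪p∣≡1+∣p∣ (suc x) (inside ∷ p) x∉p = cong suc (∣⁅x⁆∪p∣≡1+∣p∣ x p (x∉p ∘ Vec.there))
∣⁅x⁆∪p∣≡1+∣p∣ (suc x) (outside ∷ p) x∉p = ∣⁅x⁆∪p∣≡1+∣p∣ x p (x∉p ∘ Vec.there)

∣fromList∣ : ∀ {n} {xs : List (Fin n)} → Unique xs → ∣ fromList xs ∣ ≡ length xs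
∣fromList∣ {n} [] = ∣⊥∣≡0 n
∣fromList∣ {xs = x ∷ xs} (x∉xs ∷ xs!) = trans
  (∣⁅x⁆∪p∣≡1+∣p∣ x (fromList xs) (λ x∈ → All.lookup x∉xs (∈-fromList⁻ xs x∈) refl))
  (cong suc (∣fromList∣ xs!))

triangle : ℕ → ℕ
triangle zero = zero
triangle (suc m) = m + triangle m

triangle-double : ∀ m → triangle (suc m) + triangle (suc m) ≡ suc m * m
triangle-double zero = refl
triangle-double (suc m) = begin
  (suc m + triangle (suc m)) + (suc m + triangle (suc m)) ≡⟨ regroup (suc m) (triangle (suc m)) ⟩
  (suc m + suc m) + (triangle (suc m) + triangle (suc m)) ≡⟨ cong ((suc m + suc m) +_) (triangle-double m) ⟩
  (suc m + suc m) + suc m * m                             ≡⟨ expand m ⟩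
  suc (suc m) * suc m                                     ∎
  where
    open ≡-Reasoning
    regroup : ∀ x y → (x + y) + (x + y) ≡ (x + x) + (y + y)
    regroup = solve-∀
    expand : ∀ m → (suc m + suc m) + suc m * m ≡ suc (suc m) * suc m
    expand = solve-∀

module _ {n : ℕ} where

  Ordered : Edge n → Set
  Ordered e = proj₁ e <ᶠ proj₂ e

  Meets : List (Fin n) → Edge n → Set
  Meets L e = proj₁ e ∈ L ⊎ proj₂ e ∈ L

  Within : List (Fin n) → Edge n → Set
  Within L e = proj₁ e ∈ L × proj₂ e ∈ L

  normalise : Fin n → Fin n → Edge n
  normalise s t with s Fin.<? t
  ... | yes _ = s , t
  ... | no _ = t , s

  normalise-endpoints : ∀ s t → normalise s t ≡ (s , t) ⊎ normalise s t ≡ (t , s)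
  normalise-endpoints s t with s Fin.<? t
  ... | yes _ = inj₁ refl
  ... | no _ = inj₂ refl

  normalise-Ordered : ∀ {s t} → s ≢ t → Ordered (normalise s t)
  normalise-Ordered {s} {t} s≢t with s Fin.<? t
  ... | yes s<t = s<t
  ... | no s≮t with Fin.<-cmp s t
  ...   | tri< s<t _ _ = contradiction s<t s≮t
  ...   | tri≈ _ s≡t _ = contradiction s≡t s≢t
  ...   | tri> _ _ t<s = t<s

  normalise-ordered : ∀ {a b} → a <ᶠ b → normalise a b ≡ (a , b)
  normalise-ordered {a} {b} a<b with a Fin.<? b
  ... | yes _ = refl
  ... | no a≮b = contradiction a<b a≮b

  normalise-reversed : ∀ {a b} → a <ᶠ b → normalise b a ≡ (a , b)
  normalise-reversed {a} {b} a<b with b Fin.<? a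
  ... | yes b<a = contradiction b<a (Fin.<-asym a<b)
  ... | no _ = refl

  normalise-preserves : (P : Fin n → Fin n → Set) → Symmetric P →
                        ∀ {s t} → P s t → P (proj₁ (normalise s t)) (proj₂ (normalise s t))
  normalise-preserves P sym-P {s} {t} Pst with normalise s t | normalise-endpoints s t
  ... | _ | inj₁ refl = Pst
  ... | _ | inj₂ refl = sym-P Pst

  pairsWithin : List (Fin n) → List (Edge n)
  pairsWithin [] = []
  pairsWithin (s ∷ ss) = map (normalise s) ss ++ pairsWithin ss

  pairsBetween : List (Fin n) → List (Fin n) → List (Edge n)
  pairsBetween [] C = []
  pairsBetween (s ∷ ss) C = map (normalise s) C ++ pairsBetween ss C

  length-pairsWithin : ∀ L → length (pairsWithin L) ≡ triangle (length L)
  length-pairsWithin [] = refl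
  length-pairsWithin (s ∷ ss) = begin
    length (map (normalise s) ss ++ pairsWithin ss)        ≡⟨ length-++ (map (normalise s) ss) ⟩
    length (map (normalise s) ss) + length (pairsWithin ss) ≡⟨ cong₂ _+_ (length-map (normalise s) ss) (length-pairsWithin ss) ⟩
    length ss + triangle (length ss)                         ∎
    where open ≡-Reasoning

  length-pairsBetween : ∀ L C → length (pairsBetween L C) ≡ length L * length C
  length-pairsBetween [] C = refl
  length-pairsBetween (s ∷ ss) C = begin
    length (map (normalise s) C ++ pairsBetween ss C)        ≡⟨ length-++ (map (normalise s) C) ⟩
    length (map (normalise s) C) + length (pairsBetween ss C) ≡⟨ cong₂ _+_ (length-map (normalise s) C) (length-pairsBetween ss C) ⟩
    length C + length ss * length C                            ∎
    where open ≡-Reasoning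

  ∈-map-normalise : ∀ {a b s t ts} → a <ᶠ b → (s , t) ≡ (a , b) ⊎ (s , t) ≡ (b , a) → t ∈ ts →
                    (a , b) ∈ map (normalise s) ts
  ∈-map-normalise {s = s} a<b (inj₁ refl) t∈ts = subst (_∈ _) (normalise-ordered a<b) (∈-map⁺ (normalise s) t∈ts)
  ∈-map-normalise {s = s} a<b (inj₂ refl) t∈ts = subst (_∈ _) (normalise-reversed a<b) (∈-map⁺ (normalise s) t∈ts)

  ∈-pairsWithin : ∀ {e} L → Ordered e → Within L e → e ∈ pairsWithin L
  ∈-pairsWithin (s ∷ ss) a<b (here refl , here refl) = ⊥-elim (Fin.<-irrefl refl a<b)
  ∈-pairsWithin (s ∷ ss) a<b (here refl , there b∈ss) = ∈-++⁺ˡ (∈-map-normalise a<b (inj₁ refl) b∈ss)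
  ∈-pairsWithin (s ∷ ss) a<b (there a∈ss , here refl) = ∈-++⁺ˡ (∈-map-normalise a<b (inj₂ refl) a∈ss)
  ∈-pairsWithin (s ∷ ss) a<b (there a∈ss , there b∈ss) = ∈-++⁺ʳ _ (∈-pairsWithin ss a<b (a∈ss , b∈ss))

  ∈-pairsBetween : ∀ {a b} L C → a <ᶠ b → (a ∈ L × b ∈ C) ⊎ (b ∈ L × a ∈ C) → (a , b) ∈ pairsBetween L C
  ∈-pairsBetween (s ∷ ss) C a<b (inj₁ (here refl , b∈C)) = ∈-++⁺ˡ (∈-map-normalise a<b (inj₁ refl) b∈C)
  ∈-pairsBetween (s ∷ ss) C a<b (inj₂ (here refl , a∈C)) = ∈-++⁺ˡ (∈-map-normalise a<b (inj₂ refl) a∈C)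
  ∈-pairsBetween (s ∷ ss) C a<b (inj₁ (there a∈ss , b∈C)) = ∈-++⁺ʳ _ (∈-pairsBetween ss C a<b (inj₁ (a∈ss , b∈C)))
  ∈-pairsBetween (s ∷ ss) C a<b (inj₂ (there b∈ss , a∈C)) = ∈-++⁺ʳ _ (∈-pairsBetween ss C a<b (inj₂ (b∈ss , a∈C)))

  _≟ₑ_ : DecidableEquality (Edge n)
  _≟ₑ_ = ≡-dec _≟_ _≟_

  within-bound : ∀ L {E} → Unique E → All (λ e → Ordered e × Within L e) E → length E ≤ triangle (length L)
  within-bound L E! E-within = subst (_ ≤_) (length-pairsWithin L)
    (Unique-⊆⇒length≤ _≟ₑ_ E! (λ e∈E → let e< , e-within = All.lookup E-within e∈E in ∈-pairsWithin L e< e-within))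

  meeting-bound : ∀ L {E} → Unique E → All (λ e → Ordered e × Meets L e) E →
                  length E ≤ triangle (length L) + length L * length (complementOf L)
  meeting-bound L {E} E! E-meets = begin
    length E                                                     ≤⟨ Unique-⊆⇒length≤ _≟ₑ_ E! (λ e∈E → meeting-∈ (All.lookup E-meets e∈E)) ⟩
    length (pairsWithin L ++ pairsBetween L (complementOf L))     ≡⟨ length-++ (pairsWithin L) ⟩
    length (pairsWithin L) + length (pairsBetween L (complementOf L)) ≡⟨ cong₂ _+_ (length-pairsWithin L) (length-pairsBetween L _) ⟩
    triangle (length L) + length L * length (complementOf L)     ∎
    where
      open ≤-Reasoning
      open DecMembership (_≟_ {n}) using (_∈?_; _∉?_)
      meeting-∈ : ∀ {e} → Ordered e × Meets L e → e ∈ pairsWithin L ++ pairsBetween L (complementOf L)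
      meeting-∈ {a , b} (a<b , a∈L⊎b∈L) with a ∈? L | b ∈? L
      ... | yes a∈L | yes b∈L = ∈-++⁺ˡ (∈-pairsWithin L a<b (a∈L , b∈L))
      ... | yes a∈L | no b∉L = ∈-++⁺ʳ _ (∈-pairsBetween L _ a<b (inj₁ (a∈L , ∈-filter⁺ (_∉? L) (∈-allFin b) b∉L)))
      ... | no a∉L | yes b∈L = ∈-++⁺ʳ _ (∈-pairsBetween L _ a<b (inj₂ (b∈L , ∈-filter⁺ (_∉? L) (∈-allFin a) a∉L)))
      ... | no a∉L | no b∉L = contradiction a∈L⊎b∈L [ a∉L , b∉L ]′

-- Exploring a connected subgraph

SpanningEdge : ∀ {n} → List (Edge n) → List (Fin n) → Edge n → Set
SpanningEdge T L e = Ordered e × EdgeIn T (proj₁ e) (proj₂ e) × Meets L e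

swap-EdgeIn : ∀ {n} {T : List (Edge n)} → Symmetric (EdgeIn T)
swap-EdgeIn (inj₁ uv∈T) = inj₂ uv∈T
swap-EdgeIn (inj₂ vu∈T) = inj₁ vu∈T

module Exploration {n : ℕ} (T : List (Edge n)) (L : List (Fin n)) (r : Fin n) where
  open DecMembership (_≟_ {n}) using (_∈?_)

  record State : Set where
    field
      reached discovered : List (Fin n)
      edges : List (Edge n)
      root-reached : r ∈ reached
      edges-spanning : All (SpanningEdge T L) edges
      edges-unique : Unique edges
      edges-reached : All (Within reached) edges
      one-edge-each : length discovered ≡ length edges
      covers : ∀ {y} → y ∈ reached → y ∈ L → y ≡ r ⊎ y ∈ discovered
  open State

  initial : State
  initial = record
    { reached = [ r ] ; discovered = [] ; edges = [] ; root-reached = here refl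
    ; edges-spanning = [] ; edges-unique = [] ; edges-reached = [] ; one-edge-each = refl
    ; covers = λ { (here refl) _ → inj₁ refl } }

  Within-there : ∀ {y R} {E : List (Edge n)} → All (Within R) E → All (Within (y ∷ R)) E
  Within-there = All.map λ { (a∈R , b∈R) → there a∈R , there b∈R }

  visit-unlisted : (st : State) {y : Fin n} → y ∉ L → State
  visit-unlisted st {y} y∉L = record st
    { reached = y ∷ reached st
    ; root-reached = there (root-reached st)
    ; edges-reached = Within-there (edges-reached st)
    ; covers = λ { (here refl) y∈L → contradiction y∈L y∉L ; (there y∈R) → covers st y∈R } }

  visit-listed : (st : State) {x y : Fin n} → x ∈ reached st → EdgeIn T x y → y ∉ reached st → y ∈ L → State
  visit-listed st {x} {y} x∈R xy y∉R y∈L = record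
    { reached = y ∷ reached st
    ; discovered = y ∷ discovered st
    ; edges = normalise x y ∷ edges st
    ; root-reached = there (root-reached st)
    ; edges-spanning = ( normalise-Ordered x≢y
                       , normalise-preserves (EdgeIn T) swap-EdgeIn xy
                       , normalise-preserves (λ u v → u ∈ L ⊎ v ∈ L) Sum.swap (inj₂ y∈L) )
                     ∷ edges-spanning st
    ; edges-unique = All.map new-edge (edges-reached st) ∷ edges-unique st
    ; edges-reached = normalise-preserves (λ u v → u ∈ y ∷ reached st × v ∈ y ∷ reached st) Product.swap
                        (there x∈R , here refl)
                    ∷ Within-there (edges-reached st)
    ; one-edge-each = cong suc (one-edge-each st)
    ; covers = λ { (here refl) _ → inj₂ (here refl)
                 ; (there z∈R) z∈L → Sum.map₂ there (covers st z∈R z∈L) } }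
    where
      x≢y : x ≢ y
      x≢y x≡y = y∉R (subst (_∈ reached st) x≡y x∈R)
      new-edge : ∀ {e} → Within (reached st) e → normalise x y ≢ e
      new-edge e-within xy≡e with normalise-endpoints x y
      ... | inj₁ xy≡ = y∉R (proj₂ (subst (Within (reached st)) (trans (sym xy≡e) xy≡) e-within))
      ... | inj₂ yx≡ = y∉R (proj₁ (subst (Within (reached st)) (trans (sym xy≡e) yx≡) e-within))

  follow : (st : State) {x s : Fin n} → x ∈ reached st → Walk T x s →
           Σ State λ st′ → s ∈ reached st′ × reached st ⊆ reached st′
  follow st x∈R here = st , x∈R , id
  follow st x∈R (step {v = y} xy walk) with y ∈? reached st
  ... | yes y∈R = follow st y∈R walk
  ... | no y∉R with y ∈? L
  ...   | yes y∈L = let st′ , s∈R′ , R⊆R′ = follow (visit-listed st x∈R xy y∉R y∈L) (here refl) walk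
                    in st′ , s∈R′ , R⊆R′ ∘ there
  ...   | no y∉L = let st′ , s∈R′ , R⊆R′ = follow (visit-unlisted st y∉L) (here refl) walk
                   in st′ , s∈R′ , R⊆R′ ∘ there

  reach-all : Connected T → VertexOf T r → (st : State) (ss : List (Fin n)) → (∀ {s} → s ∈ ss → VertexOf T s) →
              Σ State λ st′ → ss ⊆ reached st′ × reached st ⊆ reached st′
  reach-all _ _ st [] _ = st , (λ ()) , id
  reach-all conn r∈T st (s ∷ ss) ss∈T =
    let st₁ , s∈R₁ , R⊆R₁ = follow st (root-reached st) (conn r s r∈T (ss∈T (here refl)))
        st₂ , ss⊆R₂ , R₁⊆R₂ = reach-all conn r∈T st₁ ss (ss∈T ∘ there)
    in st₂ , (λ { (here refl) → R₁⊆R₂ s∈R₁ ; (there s∈ss) → ss⊆R₂ s∈ss }) , R₁⊆R₂ ∘ R⊆R₁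

  spanning-edges : Connected T → VertexOf T r → (∀ {s} → s ∈ L → VertexOf T s) →
                   ∃ λ E → Unique E × All (SpanningEdge T L) E × ∃ λ D → length D ≡ length E × L ⊆ r ∷ D
  spanning-edges conn r∈T L∈T =
    let st , L⊆R , _ = reach-all conn r∈T initial L L∈T
    in edges st , edges-unique st , edges-spanning st , discovered st , one-edge-each st ,
       λ s∈L → [ here , there ]′ (covers st (L⊆R s∈L) s∈L)

-- Edges an S-tree spends near S

module _ {n : ℕ} (L : List (Fin n)) where
  open DecMembership (_≟_ {n}) using (_∈?_)

  within? : Decidable (Within L)
  within? e = (proj₁ e ∈? L) ×-dec (proj₂ e ∈? L)

  weight : ℕ → List (Edge n) → ℕ
  weight m E = m * length E + length (filter within? E)

  weight-++ : ∀ m xs ys → weight m (xs ++ ys) ≡ weight m xs + weight m ys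
  weight-++ m xs ys = begin
    m * length (xs ++ ys) + length (filter within? (xs ++ ys))
      ≡⟨ cong₂ (λ a b → m * a + length b) (length-++ xs) (filter-++ within? xs ys) ⟩
    m * (length xs + length ys) + length (filter within? xs ++ filter within? ys)
      ≡⟨ cong (m * (length xs + length ys) +_) (length-++ (filter within? xs)) ⟩
    m * (length xs + length ys) + (length (filter within? xs) + length (filter within? ys))
      ≡⟨ interchange m (length xs) (length ys) _ _ ⟩
    weight m xs + weight m ys ∎
    where
      open ≡-Reasoning
      interchange : ∀ m a b c d → m * (a + b) + (c + d) ≡ (m * a + c) + (m * b + d)
      interchange = solve-∀

  SpanOfWeight : List (Edge n) → ℕ → Set
  SpanOfWeight T m = ∃ λ E → Unique E × All (SpanningEdge T L) E × m * suc m ≤ weight m E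

  -- If T has a vertex outside L, root the search there: every vertex of L gets its own edge.
  -- Otherwise all edges of T lie inside L, each weighing m + 1, and one fewer edge suffices.
  tree-weight : ∀ {m} T → Unique L → length L ≡ suc m → Connected T → (∀ {s} → s ∈ L → VertexOf T s) →
                SpanOfWeight T m
  tree-weight {m} T L! |L| conn L∈T with all? within? T
  ... | yes T-within = rooted-inside L refl
    where
      edge-within : ∀ {a b} → EdgeIn T a b → Within L (a , b)
      edge-within (inj₁ ab∈T) = All.lookup T-within ab∈T
      edge-within (inj₂ ba∈T) = Product.swap (All.lookup T-within ba∈T)
      rooted-inside : ∀ L′ → L′ ≡ L → SpanOfWeight T m
      rooted-inside [] refl = contradiction |L| λ ()
      rooted-inside (r ∷ _) refl =
        let E , E! , E-spanning , D , |D| , L⊆r∷D = Exploration.spanning-edges T L r conn (L∈T (here refl)) L∈T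
            m≤|E| : m ≤ length E
            m≤|E| = ≤-pred (subst₂ _≤_ |L| (cong suc |D|) (Unique-⊆⇒length≤ _≟_ L! L⊆r∷D))
            filter-E : filter within? E ≡ E
            filter-E = filter-all within? (All.map (edge-within ∘ proj₁ ∘ proj₂) E-spanning)
        in E , E! , E-spanning , (begin
          m * suc m                        ≡⟨ *-comm m (suc m) ⟩
          suc m * m                        ≤⟨ *-monoʳ-≤ (suc m) m≤|E| ⟩
          length E + m * length E          ≡⟨ +-comm (length E) _ ⟩
          m * length E + length E          ≡⟨ cong (λ F → m * length E + length F) (sym filter-E) ⟩
          weight m E                       ∎)
        where open ≤-Reasoning
  ... | no T⊈L with find (¬All⇒Any¬ within? T T⊈L)
  ...   | (a , b) , ab∈T , ¬ab-within = rooted-outside root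
    where
      root : ∃ λ r → VertexOf T r × r ∉ L
      root with a ∈? L
      ... | no a∉L = a , (b , inj₁ ab∈T) , a∉L
      ... | yes a∈L = b , (a , inj₂ ab∈T) , λ b∈L → ¬ab-within (a∈L , b∈L)
      rooted-outside : ∃ (λ r → VertexOf T r × r ∉ L) → SpanOfWeight T m
      rooted-outside (r , r∈T , r∉L) =
        let E , E! , E-spanning , D , |D| , L⊆r∷D = Exploration.spanning-edges T L r conn r∈T L∈T
            L⊆D : L ⊆ D
            L⊆D s∈L = [ (λ s≡r → contradiction (subst (_∈ L) s≡r s∈L) r∉L) , id ]′ (Any.toSum (L⊆r∷D s∈L))
            k≤|E| : suc m ≤ length E
            k≤|E| = subst₂ _≤_ |L| |D| (Unique-⊆⇒length≤ _≟_ L! L⊆D)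
        in E , E! , E-spanning , ≤-trans (*-monoʳ-≤ m k≤|E|) (m≤m+n _ _)

-- A k-set met by k edges of M

module _ {n : ℕ} where

  Incident : Edge n → Fin n → Set
  Incident e v = proj₁ e ≡ v ⊎ proj₂ e ≡ v

  incident-edge : ∀ M v → 1 ≤ deg M v → ∃ λ e → e ∈ M × Incident e v
  incident-edge ((a , b) ∷ M) v 1≤d with a ≟ v | b ≟ v
  ... | yes a≡v | _ = (a , b) , here refl , inj₁ a≡v
  ... | no _ | yes b≡v = (a , b) , here refl , inj₂ b≡v
  ... | no _ | no _ = let e , e∈M , e-v = incident-edge M v 1≤d in e , there e∈M , e-v

  two-incident-edges : ∀ M v → Unique M → 2 ≤ deg M v →
                       ∃₂ λ e f → e ∈ M × f ∈ M × e ≢ f × Incident e v × Incident f v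
  two-incident-edges ((a , b) ∷ M) v (ab∉M ∷ M!) 2≤d with a ≟ v | b ≟ v
  ... | yes a≡v | _ = let f , f∈M , f-v = incident-edge M v (≤-pred 2≤d)
                      in (a , b) , f , here refl , there f∈M , All.lookup ab∉M f∈M , inj₁ a≡v , f-v
  ... | no _ | yes b≡v = let f , f∈M , f-v = incident-edge M v (≤-pred 2≤d)
                         in (a , b) , f , here refl , there f∈M , All.lookup ab∉M f∈M , inj₂ b≡v , f-v
  ... | no _ | no _ = let e , f , e∈M , f∈M , e≢f , e-v , f-v = two-incident-edges M v M! 2≤d
                      in e , f , there e∈M , there f∈M , e≢f , e-v , f-v

  record HeavySet (k : ℕ) (M : List (Edge n)) : Set where
    field
      vertices : List (Fin n)
      vertices-unique : Unique vertices
      vertices-length : length vertices ≡ k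
      meeting : List (Edge n)
      meeting-unique : Unique meeting
      meeting-length : k ≤ length meeting
      meeting-edges : All (λ e → e ∈ M × Meets vertices e) meeting
      inner : Edge n
      inner∈M : inner ∈ M
      inner-within : Within vertices inner

  -- Take two edges e, f of M at a vertex of degree ≥ 2 and k − 2 further edges of M; the endpoints
  -- of e and one endpoint of each further edge are k vertices, and f meets them at the common vertex.
  heavySet : ∀ {k} (M : List (Edge n)) → 2 ≤ k → k ≤ n → Unique M → k ≤ length M → MaxDeg≥ M 2 → HeavySet k M
  heavySet {k} M 2≤k k≤n M! k≤|M| (v , 2≤deg) with two-incident-edges M v M! 2≤deg
  ... | e , f , e∈M , f∈M , e≢f , e-v , f-v = record
    { vertices = L ; vertices-unique = L! ; vertices-length = |L|
    ; meeting = e ∷ f ∷ rest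
    ; meeting-unique = (e≢f ∷ All.tabulate (not-in-rest (here refl))) ∷ All.tabulate (not-in-rest (there (here refl)))
                     ∷ take⁺ (k ∸ 2) (filter⁺ (_∉? (e ∷ f ∷ [])) M!)
    ; meeting-length = ≤-reflexive (sym (trans (cong (2 +_) |rest|) (m+[n∸m]≡n 2≤k)))
    ; meeting-edges = (e∈M , inj₁ (seeds⊆L (here refl)))
                    ∷ (f∈M , [ (λ f₁≡v → inj₁ (subst (_∈ L) (sym f₁≡v) v∈L)) , (λ f₂≡v → inj₂ (subst (_∈ L) (sym f₂≡v) v∈L)) ]′ f-v)
                    ∷ All.tabulate (λ g∈rest → proj₁ (∈-filter⁻ (_∉? (e ∷ f ∷ [])) {xs = M} (rest⊆others g∈rest))
                                             , inj₁ (seeds⊆L (there (there (∈-map⁺ proj₁ g∈rest)))))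
    ; inner = e ; inner∈M = e∈M ; inner-within = seeds⊆L (here refl) , seeds⊆L (there (here refl)) }
    where
      open DecMembership _≟ₑ_ using (_∈?_; _∉?_)
      others = filter (_∉? (e ∷ f ∷ [])) M
      rest = take (k ∸ 2) others
      rest⊆others : rest ⊆ others
      rest⊆others = Sublist.lookup (SublistProperties.take-⊆ (setoid (Edge n)) (k ∸ 2) others)
      not-in-rest : ∀ {d g} → d ∈ e ∷ f ∷ [] → g ∈ rest → d ≢ g
      not-in-rest d∈ef g∈rest d≡g = proj₂ (∈-filter⁻ (_∉? (e ∷ f ∷ [])) {xs = M} (rest⊆others g∈rest)) (subst (_∈ _) d≡g d∈ef)
      M⊆ef++others : M ⊆ e ∷ f ∷ others
      M⊆ef++others {g} g∈M with g ∈? (e ∷ f ∷ [])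
      ... | yes g∈ef = ∈-++⁺ˡ g∈ef
      ... | no g∉ef = there (there (∈-filter⁺ (_∉? (e ∷ f ∷ [])) g∈M g∉ef))
      k∸2≤|others| : k ∸ 2 ≤ length others
      k∸2≤|others| = ∸-monoˡ-≤ 2 (≤-trans k≤|M| (Unique-⊆⇒length≤ _≟ₑ_ M! M⊆ef++others))
      |rest| : length rest ≡ k ∸ 2
      |rest| = trans (length-take (k ∸ 2) others) (m≤n⇒m⊓n≡m k∸2≤|others|)
      seeds = proj₁ e ∷ proj₂ e ∷ map proj₁ rest
      |seeds| : length seeds ≡ k
      |seeds| = trans (cong (2 +_) (trans (length-map proj₁ rest) |rest|)) (m+[n∸m]≡n 2≤k)
      superset = Unique-superset-of-length seeds (≤-reflexive |seeds|) k≤n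
      L = proj₁ superset
      L! = proj₁ (proj₂ superset)
      |L| = proj₁ (proj₂ (proj₂ superset))
      seeds⊆L = proj₂ (proj₂ (proj₂ superset))
      v∈L : v ∈ L
      v∈L = [ (λ e₁≡v → subst (_∈ L) e₁≡v (seeds⊆L (here refl))) , (λ e₂≡v → subst (_∈ L) e₂≡v (seeds⊆L (there (here refl)))) ]′ e-v

-- Counting the edges of edge-disjoint S-trees

module Counting {n m t : ℕ} {M : List (Edge n)} (M-ordered : All Ordered M) (H : HeavySet (suc m) M)
                (T : Fin t → List (Edge n))
                (T-STree : ∀ i → IsSTree (Kn∖ M) (fromList (HeavySet.vertices H)) (T i))
                (T-disjoint : ∀ i j → i ≢ j → EdgeDisjoint (T i) (T j)) where
  open HeavySet H

  tree-edges : ∀ i → SpanOfWeight vertices (T i) m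
  tree-edges i = let _ , (conn , _) , S⊆T = T-STree i
                 in tree-weight vertices (T i) vertices-unique vertices-length conn (S⊆T _ ∘ ∈-fromList⁺)

  E : Fin t → List (Edge n)
  E i = proj₁ (tree-edges i)

  E-spanning : ∀ i → All (SpanningEdge (T i) vertices) (E i)
  E-spanning i = proj₁ (proj₂ (proj₂ (tree-edges i)))

  D : List (Edge n)
  D = concat (tabulate E)

  D-unique : Unique D
  D-unique = concat⁺ (tabulate⁺ (proj₁ ∘ proj₂ ∘ tree-edges)) (AllPairs.tabulate⁺ disjoint)
    where
      disjoint : ∀ {i j} → i ≢ j → Disjoint (E i) (E j)
      disjoint {i} {j} i≢j (e∈Ei , e∈Ej) = T-disjoint i j i≢j _ _
        (proj₁ (proj₂ (All.lookup (E-spanning i) e∈Ei))) (proj₁ (proj₂ (All.lookup (E-spanning j) e∈Ej)))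

  D-spanning : ∀ {e} → e ∈ D → ∃ λ i → SpanningEdge (T i) vertices e
  D-spanning e∈D with ∈-concat⁻′ (tabulate E) e∈D
  ... | _ , e∈F , F∈E with ∈-tabulate⁻ F∈E
  ...   | i , refl = i , All.lookup (E-spanning i) e∈F

  D∉M : ∀ {e} → e ∈ D → ¬ EdgeIn M (proj₁ e) (proj₂ e)
  D∉M e∈D with D-spanning e∈D
  ... | i , _ , inj₁ e∈Ti , _ = proj₂ (All.lookup (proj₁ (T-STree i)) e∈Ti)
  ... | i , _ , inj₂ e′∈Ti , _ = proj₂ (All.lookup (proj₁ (T-STree i)) e′∈Ti) ∘ swap-EdgeIn

  -- Tree edges avoid M, so the k edges of M meeting S come on top of them.
  meeting-count : suc m + length D ≤ triangle (suc m) + suc m * length (complementOf vertices)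
  meeting-count = begin
    suc m + length D                                      ≤⟨ +-monoˡ-≤ (length D) meeting-length ⟩
    length meeting + length D                             ≡⟨ length-++ meeting ⟨
    length (meeting ++ D)                                 ≤⟨ meeting-bound vertices (++⁺ meeting-unique D-unique disjoint)
                                                                                    (All-++⁺ meeting-ordered D-meets) ⟩
    triangle (length vertices) + length vertices * length (complementOf vertices)
                                                          ≡⟨ cong (λ k → triangle k + k * length (complementOf vertices)) vertices-length ⟩
    triangle (suc m) + suc m * length (complementOf vertices) ∎
    where
      open ≤-Reasoning
      disjoint : Disjoint meeting D
      disjoint (e∈meeting , e∈D) = D∉M e∈D (inj₁ (proj₁ (All.lookup meeting-edges e∈meeting)))
      meeting-ordered : All (λ e → Ordered e × Meets vertices e) meeting
      meeting-ordered = All.map (λ (e∈M , e-meets) → All.lookup M-ordered e∈M , e-meets) meeting-edges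
      D-meets : All (λ e → Ordered e × Meets vertices e) D
      D-meets = All.tabulate λ e∈D → let _ , e< , _ , e-meets = D-spanning e∈D in e< , e-meets

  within-count : suc (length (filter (within? vertices) D)) ≤ triangle (suc m)
  within-count = subst (suc (length (filter (within? vertices) D)) ≤_) (cong triangle vertices-length)
    (within-bound vertices (All.tabulate inner∉ ∷ filter⁺ (within? vertices) D-unique)
      ((All.lookup M-ordered inner∈M , inner-within) ∷ All.tabulate filtered-within))
    where
      inner∉ : ∀ {e} → e ∈ filter (within? vertices) D → inner ≢ e
      inner∉ e∈ refl = D∉M (proj₁ (∈-filter⁻ (within? vertices) {xs = D} e∈)) (inj₁ inner∈M)
      filtered-within : ∀ {e} → e ∈ filter (within? vertices) D → Ordered e × Within vertices e
      filtered-within e∈ = let e∈D , e-within = ∈-filter⁻ (within? vertices) {xs = D} e∈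
                  in proj₁ (proj₂ (D-spanning e∈D)) , e-within

  weight-count : t * (m * suc m) ≤ weight vertices m D
  weight-count = subst (λ x → x * (m * suc m) ≤ weight vertices m D) (length-tabulate E)
    (additive-concat-lower-bound (weight vertices m) (weight-++ vertices m)
      (tabulate⁺ (proj₂ ∘ proj₂ ∘ proj₂ ∘ tree-edges)))

-- m times the meeting count plus the within count bounds m X + Y, hence the weighted tree count;
-- doubling and using t + 1 ≥ c + h gives P · 2(t + 1) < P · 2(t + 1) for P = m(m + 1).
counting-contradiction : ∀ {m h c t X Y} → suc m ≡ h * 2 → c + h ≤ suc t →
  suc m + X ≤ triangle (suc m) + suc m * c → suc Y ≤ triangle (suc m) → t * (m * suc m) ≤ m * X + Y → ⊥
counting-contradiction {m} {h} {c} {t} {X} {Y} k≡h*2 c+h≤1+t meeting within weighted = <-irrefl refl (begin-strict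
  P * (2 * suc t)                                ≡⟨ split-trees P t ⟩
  2 * (t * P) + 2 * P                            ≤⟨ +-monoˡ-≤ (2 * P) (*-monoʳ-≤ 2 weighted) ⟩
  2 * (m * X + Y) + 2 * P                        <⟨ m<m+n _ {2} z<s ⟩
  2 * (m * X + Y) + 2 * P + 2                    ≡⟨ regroup m X Y ⟩
  2 * (m * (suc m + X) + suc Y)                  ≤⟨ *-monoʳ-≤ 2 (+-mono-≤ (*-monoʳ-≤ m meeting) within) ⟩
  2 * (m * (Tk + suc m * c) + Tk)                ≡⟨ expand m Tk c ⟩
  m * (Tk + Tk) + (Tk + Tk) + 2 * (P * c)        ≡⟨ cong (λ z → m * z + z + 2 * (P * c)) (triangle-double m) ⟩
  m * (suc m * m) + suc m * m + 2 * (P * c)      ≡⟨ factor m c ⟩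
  P * (suc m + 2 * c)                            ≡⟨ cong (λ k → P * (k + 2 * c)) k≡h*2 ⟩
  P * (h * 2 + 2 * c)                            ≡⟨ cong (P *_) (double-sum h c) ⟩
  P * (2 * (c + h))                              ≤⟨ *-monoʳ-≤ P (*-monoʳ-≤ 2 c+h≤1+t) ⟩
  P * (2 * suc t)                                ∎)
  where
    open ≤-Reasoning
    P = m * suc m
    Tk = triangle (suc m)
    split-trees : ∀ P t → P * (2 * suc t) ≡ 2 * (t * P) + 2 * P
    split-trees = solve-∀
    regroup : ∀ m X Y → 2 * (m * X + Y) + 2 * (m * suc m) + 2 ≡ 2 * (m * (suc m + X) + suc Y)
    regroup = solve-∀
    expand : ∀ m T c → 2 * (m * (T + suc m * c) + T) ≡ m * (T + T) + (T + T) + 2 * (m * suc m * c)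
    expand = solve-∀
    factor : ∀ m c → m * (suc m * m) + suc m * m + 2 * (m * suc m * c) ≡ m * suc m * (suc m + 2 * c)
    factor = solve-∀
    double-sum : ∀ h c → h * 2 + 2 * c ≡ 2 * (c + h)
    double-sum = solve-∀

complement-slack : ∀ {n c k h} → c + k ≤ n → k ≡ h * 2 → c + h ≤ suc (n ∸ k / 2 ∸ 1)
complement-slack {n} {c} {h = h} c+k≤n refl = subst (λ x → c + h ≤ suc (n ∸ x ∸ 1)) (sym (m*n/n≡m h 2))
  (≤-trans (m+n≤o⇒m≤o∸n (c + h) (subst (_≤ n) (regroup c h) c+k≤n)) (m≤n+m∸n (n ∸ h) 1))
  where
    regroup : ∀ c h → c + h * 2 ≡ c + h + h
    regroup = solve-∀

lemma7 : (n k : ℕ) → 4 ≤ k → k ≤ n → 2 ∣ k →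
    (M : List (Edge n)) → IsEdgeSetOfKn M → k ≤ length M → MaxDeg≥ M 2 →
    LambdaK< (Kn∖ M) k (n ∸ k / 2 ∸ 1)
lemma7 n (suc m) 4≤k k≤n (divides h k≡h*2) M (M-ordered , M!) k≤|M| Δ≥2 =
  fromList vertices , trans (∣fromList∣ vertices-unique) vertices-length , no-trees
  where
    H = heavySet M (≤-trans (s≤s (s≤s z≤n)) 4≤k) k≤n M! k≤|M| Δ≥2
    open HeavySet H
    complement : length (complementOf vertices) + h ≤ suc (n ∸ suc m / 2 ∸ 1)
    complement = complement-slack (subst (λ k → length (complementOf vertices) + k ≤ n) vertices-length
                                    (length-complementOf+length≤ vertices vertices-unique)) k≡h*2
    no-trees : ¬ HasDisjointSTrees (Kn∖ M) (fromList vertices) (n ∸ suc m / 2 ∸ 1)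
    no-trees (T , T-STree , T-disjoint) = counting-contradiction k≡h*2 complement meeting-count within-count weight-count
      where open Counting M-ordered H T T-STree T-disjoint
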